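{- The edge-forcing number of the butterfly network $BF(3)$ is $8$: $\zeta_e(BF(3))=8$.
   Context: The $r$-dimensional butterfly network $BF(r)$ has vertex set $\{[w;i] : w\in\{0,1\}^r,\ 0\le i\le r\}$, and $[w;i]$ is adjacent to $[w';j]$ iff $j=i+1$ and either $w=w'$ or $w$ and $w'$ differ precisely in the $j$-th bit. Forcing (closure) rule: for a graph $G=(V,E)$ and $T\subseteq V$, the closure $C_G(T)$ starts as $T$ and, as long as some vertex of $C_G(T)$ has exactly one neighbor not in $C_G(T)$, that neighbor is added. Edge-forcing set: a set $K$ of pairwise independent edges of $G$ such that, with $T$ the set of endpoints of edges of $K$, $C_G(T)=V$. $\zeta_e(G)$ is the minimum cardinality of an edge-forcing set of $G$. -}

module Defs where

open import Data.Nat using (ℕ; zero; suc; _≤_)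
open import Data.Fin using (Fin; toℕ)
open import Data.Bool using (Bool)
open import Data.Vec using (Vec; lookup)
open import Data.Product using (_×_; _,_; ∃-syntax)
open import Data.Sum using (_⊎_)
open import Data.List using (List; length)
open import Data.List.Membership.Propositional using (_∈_)
open import Data.List.Relation.Unary.All using (All)
open import Data.List.Relation.Unary.AllPairs using (AllPairs)
open import Relation.Binary.PropositionalEquality using (_≡_; _≢_)
open import Relation.Nullary using (¬_)

record Graph : Set₁ where
  field
    V   : Set
    Adj : V → V → Set

module _ (G : Graph) where
  open Graph G

  Edge : V → V → Set
  Edge u v = Adj u v ⊎ Adj v u

  -- Closure C_G(T) of a vertex set T (given as a predicate), as the least
  -- set containing T and closed under the forcing rule: if u is in the
  -- closure and v is the unique neighbour of u outside the closure, v is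
  -- added.  (The forcing process is monotone, so its final result is this
  -- least fixed point.)
  data Closure (T : V → Set) : V → Set where
    base  : ∀ {v} → T v → Closure T v
    force : ∀ {u v} → Closure T u → Edge u v
          → (∀ w → Edge u w → w ≢ v → Closure T w)
          → Closure T v

  Independent : V × V → V × V → Set
  Independent (a , b) (c , d) = a ≢ c × a ≢ d × b ≢ c × b ≢ d

  Endpoints : List (V × V) → V → Set
  Endpoints K v = ∃[ e ] (e ∈ K × (Data.Product.proj₁ e ≡ v ⊎ Data.Product.proj₂ e ≡ v))

  -- Its cardinality is length K
  -- (pairwise independence makes the listed edges distinct).
  IsEdgeForcingSet : List (V × V) → Set
  IsEdgeForcingSet K =
    All (λ e → Edge (Data.Product.proj₁ e) (Data.Product.proj₂ e)) K
    × AllPairs Independent K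
    × (∀ v → Closure (Endpoints K) v)

  EdgeForcingNumberIs : ℕ → Set
  EdgeForcingNumberIs n =
    (∃[ K ] (IsEdgeForcingSet K × length K ≡ n))
    × (∀ K → IsEdgeForcingSet K → n ≤ length K)

-- Butterfly network BF(r).
-- Vertex [w;i] is the pair (w , i) with w ∈ {0,1}^r, i ∈ {0,…,r}.
-- Bits of w are numbered 1..r; bit j is  lookup w k  with toℕ k = j - 1.

DifferPreciselyAt : ∀ {r} → Vec Bool r → Vec Bool r → ℕ → Set
DifferPreciselyAt {r} w w' j =
  ∀ (k : Fin r) → (lookup w k ≢ lookup w' k → suc (toℕ k) ≡ j)
                × (suc (toℕ k) ≡ j → lookup w k ≢ lookup w' k)

BFAdj : ∀ r → (Vec Bool r × Fin (suc r)) → (Vec Bool r × Fin (suc r)) → Set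
BFAdj r (w , i) (w' , j) =
  toℕ j ≡ suc (toℕ i) × (w ≡ w' ⊎ DifferPreciselyAt w w' (toℕ j))

BF : ℕ → Graph
BF r = record { V = Vec Bool r × Fin (suc r) ; Adj = BFAdj r }

-- Upper bound: an explicit set of eight independent edges, with an explicit forcing order.
-- Lower bound: [w;0] and [w′;0] with w, w′ differing only in the first bit have the same
-- neighbourhood, and so do [w;3] and [w′;3] differing only in the last bit. Of two such twins
-- neither can be forced while the other is unknown, so an edge of every edge-forcing set meets
-- each of these eight twin pairs; as the sixteen twin vertices are pairwise non-adjacent, no edge
-- meets two pairs, giving at least eight edges.

module Submission where

open import Defs
open import Data.Nat as ℕ using (ℕ; zero; suc; _≤_)
open import Data.Fin as Fin using (Fin; toℕ; #_)
import Data.Fin.Properties as Fin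
open import Data.Bool using (Bool; true; false)
import Data.Bool.Properties as Bool
open import Data.Vec as Vec using (Vec; []; _∷_)
import Data.Vec.Properties as Vec
open import Data.Maybe as Maybe using (Maybe; just; nothing)
import Data.Maybe.Properties as Maybe
open import Data.Product using (_×_; _,_; proj₁; proj₂)
import Data.Product.Properties as Product
open import Data.Sum using (_⊎_; inj₁; inj₂; swap)
open import Data.Empty using (⊥; ⊥-elim)
open import Data.List as List
  using (List; []; _∷_; length; filter; cartesianProduct; cartesianProductWith; allFin)
open import Data.List.Membership.Propositional using (_∈_; lose)
open import Data.List.Membership.Propositional.Properties
  using (∈-filter⁺; ∈-cartesianProductWith⁺; ∈-cartesianProduct⁺; ∈-allFin)
open import Data.List.Relation.Unary.Any as Any using (Any; here; there)
open import Data.List.Relation.Unary.Any.Properties using (lookup-index)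
open import Data.List.Relation.Unary.All as All using (All; []; _∷_)
open import Data.List.Relation.Unary.AllPairs using (allPairs?)
open import Function using (_∘_)
open import Relation.Binary using (DecidableEquality)
open import Relation.Binary.PropositionalEquality using (_≡_; _≢_; refl; sym; trans; subst)
open import Relation.Unary using (Decidable)
open import Relation.Nullary using (Dec; ¬?)
open import Relation.Nullary.Decidable using (map′; from-yes; dec⇒maybe; _×-dec_; _⊎-dec_; _→-dec_)

endpoints : ∀ {A : Set} → List (A × A) → List A
endpoints []            = []
endpoints ((a , b) ∷ K) = a ∷ b ∷ endpoints K

module _ (G : Graph) where
  open Graph G

  endpoints-in-Endpoints : ∀ K → All (Endpoints G K) (endpoints K)
  endpoints-in-Endpoints []            = []
  endpoints-in-Endpoints ((a , b) ∷ K) =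
    (_ , here refl , inj₁ refl) ∷ (_ , here refl , inj₂ refl) ∷
    All.map (λ (e , e∈K , end) → e , there e∈K , end) (endpoints-in-Endpoints K)

  Twins : V → V → Set
  Twins x y = x ≢ y × (∀ u → Edge G u x → Edge G u y) × (∀ u → Edge G u y → Edge G u x)

  twins-sym : ∀ {x y} → Twins x y → Twins y x
  twins-sym (x≢y , x→y , y→x) = x≢y ∘ sym , y→x , x→y

  -- A vertex forcing x would also have to see its twin y, which therefore is already in the closure;
  -- so neither twin can be forced first.
  closure-twins : ∀ {T x y} → Twins x y → Closure G T x → T x ⊎ T y
  closure-twins _ (base Tx) = inj₁ Tx
  closure-twins tw@(x≢y , x→y , _) (force {u} _ u–x others) =
    swap (closure-twins (twins-sym tw) (others _ (x→y u u–x) (x≢y ∘ sym)))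

  -- class v is the index of the twin pair containing v, so the fields also say that the pairs
  -- are disjoint and that no edge joins two twin vertices.
  record TwinClasses (n : ℕ) : Set where
    field
      twinPair          : Fin n → V × V
      twinPair-twins    : ∀ i → Twins (proj₁ (twinPair i)) (proj₂ (twinPair i))
      class             : V → Maybe (Fin n)
      class-twinPair₁   : ∀ i → class (proj₁ (twinPair i)) ≡ just i
      class-twinPair₂   : ∀ i → class (proj₂ (twinPair i)) ≡ just i
      edge-unclassified : ∀ {a b} → Edge G a b → class a ≡ nothing ⊎ class b ≡ nothing

  module _ {n} (C : TwinClasses n) where
    open TwinClasses C

    Touches : Fin n → V × V → Set
    Touches i (a , b) = class a ≡ just i ⊎ class b ≡ just i

    classes-nonadjacent : ∀ {a b i j} → Edge G a b → class a ≡ just i → class b ≡ just j → ⊥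
    classes-nonadjacent a–b ca cb with edge-unclassified a–b
    ... | inj₁ ca′ with () ← trans (sym ca′) ca
    ... | inj₂ cb′ with () ← trans (sym cb′) cb

    touches-unique : ∀ {i j e} → Edge G (proj₁ e) (proj₂ e) → Touches i e → Touches j e → i ≡ j
    touches-unique _   (inj₁ ai) (inj₁ aj) = Maybe.just-injective (trans (sym ai) aj)
    touches-unique _   (inj₂ bi) (inj₂ bj) = Maybe.just-injective (trans (sym bi) bj)
    touches-unique a–b (inj₁ ai) (inj₂ bj) = ⊥-elim (classes-nonadjacent a–b ai bj)
    touches-unique a–b (inj₂ bi) (inj₁ aj) = ⊥-elim (classes-nonadjacent a–b aj bi)

    endpoint-touches : ∀ {i v e} → proj₁ e ≡ v ⊎ proj₂ e ≡ v → class v ≡ just i → Touches i e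
    endpoint-touches (inj₁ refl) cv = inj₁ cv
    endpoint-touches (inj₂ refl) cv = inj₂ cv

    EdgeTouching : Fin n → V × V → Set
    EdgeTouching i e = Edge G (proj₁ e) (proj₂ e) × Touches i e

    every-class-touched : ∀ {K} → IsEdgeForcingSet G K → ∀ i → Any (EdgeTouching i) K
    every-class-touched (edges , _ , closed) i
      with closure-twins (twinPair-twins i) (closed (proj₁ (twinPair i)))
    ... | inj₁ (e , e∈K , end) =
      lose e∈K (All.lookup edges e∈K , endpoint-touches end (class-twinPair₁ i))
    ... | inj₂ (e , e∈K , end) =
      lose e∈K (All.lookup edges e∈K , endpoint-touches end (class-twinPair₂ i))

    twinClasses⇒≤length : ∀ {K} → IsEdgeForcingSet G K → n ≤ length K
    twinClasses⇒≤length {K} forcing = Fin.injective⇒≤ injective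
      where
      touching : ∀ i → Any (EdgeTouching i) K
      touching = every-class-touched forcing

      injective : ∀ {i j} → Any.index (touching i) ≡ Any.index (touching j) → i ≡ j
      injective {i} {j} same with lookup-index (touching i) | lookup-index (touching j)
      ... | edge , ti | _ , tj = touches-unique edge ti (subst (Touches j ∘ List.lookup K) (sym same) tj)

module FiniteGraph (G : Graph)
                   (_≟_ : DecidableEquality (Graph.V G))
                   (edge? : ∀ u v → Dec (Edge G u v))
                   (vertices : List (Graph.V G)) (∈-vertices : ∀ v → v ∈ vertices) where

  open Graph G
  open import Data.List.Membership.DecPropositional _≟_ using (_∈?_)

  all? : ∀ {P : V → Set} → Decidable P → Dec (∀ v → P v)
  all? P? = map′ (λ all v → All.lookup all (∈-vertices v)) (λ ∀P → All.tabulate λ {v} _ → ∀P v)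
                 (All.all? P? vertices)

  twins? : ∀ x y → Dec (Twins G x y)
  twins? x y =
    ¬? (x ≟ y) ×-dec
    all? (λ u → edge? u x →-dec edge? u y) ×-dec
    all? (λ u → edge? u y →-dec edge? u x)

  independent? : ∀ e f → Dec (Independent G e f)
  independent? (a , b) (c , d) = ¬? (a ≟ c) ×-dec ¬? (a ≟ d) ×-dec ¬? (b ≟ c) ×-dec ¬? (b ≟ d)

  neighbours : V → List V
  neighbours u = filter (edge? u) vertices

  Forces : List V → V × V → Set
  Forces known (u , v) = u ∈ known × Edge G u v × All (λ w → w ≡ v ⊎ w ∈ known) (neighbours u)

  forces? : ∀ known step → Dec (Forces known step)
  forces? known (u , v) =
    (u ∈? known) ×-dec edge? u v ×-dec All.all? (λ w → (w ≟ v) ⊎-dec (w ∈? known)) (neighbours u)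

  ForcingChain : List V → List (V × V) → Set
  ForcingChain known []           = All (_∈ known) vertices
  ForcingChain known (step ∷ steps) = Forces known step × ForcingChain (proj₂ step ∷ known) steps

  forcingChain? : ∀ known steps → Dec (ForcingChain known steps)
  forcingChain? known []             = All.all? (_∈? known) vertices
  forcingChain? known (step ∷ steps) = forces? known step ×-dec forcingChain? (proj₂ step ∷ known) steps

  module _ {T : V → Set} where

    forces-closure : ∀ {known u v} → All (Closure G T) known → Forces known (u , v) → Closure G T v
    forces-closure {u = u} closed (u∈ , u–v , others) = force (All.lookup closed u∈) u–v other-closed
      where
      other-closed : ∀ w → Edge G u w → w ≢ _ → Closure G T w
      other-closed w u–w w≢v with All.lookup others (∈-filter⁺ (edge? u) (∈-vertices w) u–w)
      ... | inj₁ w≡v = ⊥-elim (w≢v w≡v)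
      ... | inj₂ w∈  = All.lookup closed w∈

    forcingChain-closure : ∀ {known} steps → All (Closure G T) known → ForcingChain known steps →
                           ∀ v → Closure G T v
    forcingChain-closure []             closed all-known v =
      All.lookup closed (All.lookup all-known (∈-vertices v))
    forcingChain-closure (step ∷ steps) closed (forces , chain) =
      forcingChain-closure steps (forces-closure closed forces ∷ closed) chain

  endpoints-forcingChain-closure : ∀ {K} steps → ForcingChain (endpoints K) steps →
                                   ∀ v → Closure G (Endpoints G K) v
  endpoints-forcingChain-closure {K} steps =
    forcingChain-closure steps (All.map base (endpoints-in-Endpoints G K))

booleans : List Bool
booleans = false ∷ true ∷ []

∈-booleans : ∀ b → b ∈ booleans
∈-booleans false = here refl
∈-booleans true  = there (here refl)

bitVectors : ∀ n → List (Vec Bool n)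
bitVectors zero    = [] ∷ []
bitVectors (suc n) = cartesianProductWith _∷_ booleans (bitVectors n)

∈-bitVectors : ∀ {n} (w : Vec Bool n) → w ∈ bitVectors n
∈-bitVectors []      = here refl
∈-bitVectors (b ∷ w) = ∈-cartesianProductWith⁺ _∷_ (∈-booleans b) (∈-bitVectors w)

module Butterfly (r : ℕ) where
  open Graph (BF r)

  vertices : List V
  vertices = cartesianProduct (bitVectors r) (allFin (suc r))

  ∈-vertices : ∀ v → v ∈ vertices
  ∈-vertices (w , i) = ∈-cartesianProduct⁺ (∈-bitVectors w) (∈-allFin i)

  _≟ᵥ_ : DecidableEquality V
  _≟ᵥ_ = Product.≡-dec (Vec.≡-dec Bool._≟_) Fin._≟_

  differPreciselyAt? : ∀ (w w′ : Vec Bool r) j → Dec (DifferPreciselyAt w w′ j)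
  differPreciselyAt? w w′ j = Fin.all? λ k →
    (¬? (Vec.lookup w k Bool.≟ Vec.lookup w′ k) →-dec (suc (toℕ k) ℕ.≟ j)) ×-dec
    ((suc (toℕ k) ℕ.≟ j) →-dec ¬? (Vec.lookup w k Bool.≟ Vec.lookup w′ k))

  adj? : ∀ u v → Dec (BFAdj r u v)
  adj? (w , i) (w′ , j) =
    (toℕ j ℕ.≟ suc (toℕ i)) ×-dec (Vec.≡-dec Bool._≟_ w w′ ⊎-dec differPreciselyAt? w w′ (toℕ j))

  edge? : ∀ u v → Dec (Edge (BF r) u v)
  edge? u v = adj? u v ⊎-dec adj? v u

open Graph (BF 3) using (V)
open Butterfly 3
open FiniteGraph (BF 3) _≟ᵥ_ edge? vertices ∈-vertices

pattern O = false
pattern I = true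

⟨_,_,_∣_⟩ : Bool → Bool → Bool → Fin 4 → V
⟨ b₁ , b₂ , b₃ ∣ i ⟩ = (b₁ ∷ b₂ ∷ b₃ ∷ []) , i

forcingEdges : List (V × V)
forcingEdges =
  (⟨ I , I , O ∣ # 0 ⟩ , ⟨ I , I , O ∣ # 1 ⟩) ∷
  (⟨ I , O , O ∣ # 0 ⟩ , ⟨ O , O , O ∣ # 1 ⟩) ∷
  (⟨ I , O , I ∣ # 0 ⟩ , ⟨ O , O , I ∣ # 1 ⟩) ∷
  (⟨ I , I , I ∣ # 0 ⟩ , ⟨ I , I , I ∣ # 1 ⟩) ∷
  (⟨ O , I , I ∣ # 2 ⟩ , ⟨ O , I , O ∣ # 3 ⟩) ∷
  (⟨ O , O , I ∣ # 2 ⟩ , ⟨ O , O , I ∣ # 3 ⟩) ∷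
  (⟨ I , I , I ∣ # 2 ⟩ , ⟨ I , I , O ∣ # 3 ⟩) ∷
  (⟨ I , O , O ∣ # 2 ⟩ , ⟨ I , O , I ∣ # 3 ⟩) ∷ []

forcingOrder : List (V × V)
forcingOrder =
  (⟨ I , O , O ∣ # 0 ⟩ , ⟨ I , O , O ∣ # 1 ⟩) ∷
  (⟨ I , O , O ∣ # 2 ⟩ , ⟨ I , O , O ∣ # 3 ⟩) ∷
  (⟨ I , O , O ∣ # 3 ⟩ , ⟨ I , O , I ∣ # 2 ⟩) ∷
  (⟨ O , I , O ∣ # 3 ⟩ , ⟨ O , I , O ∣ # 2 ⟩) ∷
  (⟨ I , I , O ∣ # 0 ⟩ , ⟨ O , I , O ∣ # 1 ⟩) ∷
  (⟨ I , I , O ∣ # 3 ⟩ , ⟨ I , I , O ∣ # 2 ⟩) ∷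
  (⟨ O , O , I ∣ # 1 ⟩ , ⟨ O , O , I ∣ # 0 ⟩) ∷
  (⟨ O , O , I ∣ # 3 ⟩ , ⟨ O , O , O ∣ # 2 ⟩) ∷
  (⟨ I , O , I ∣ # 0 ⟩ , ⟨ I , O , I ∣ # 1 ⟩) ∷
  (⟨ I , I , I ∣ # 0 ⟩ , ⟨ O , I , I ∣ # 1 ⟩) ∷
  (⟨ I , I , I ∣ # 1 ⟩ , ⟨ O , I , I ∣ # 0 ⟩) ∷
  (⟨ I , I , I ∣ # 2 ⟩ , ⟨ I , I , I ∣ # 3 ⟩) ∷
  (⟨ O , O , O ∣ # 1 ⟩ , ⟨ O , O , O ∣ # 0 ⟩) ∷
  (⟨ O , O , O ∣ # 2 ⟩ , ⟨ O , O , O ∣ # 3 ⟩) ∷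
  (⟨ O , I , O ∣ # 1 ⟩ , ⟨ O , I , O ∣ # 0 ⟩) ∷
  (⟨ O , I , O ∣ # 2 ⟩ , ⟨ O , I , I ∣ # 3 ⟩) ∷ []

forcingEdges-isEdgeForcingSet : IsEdgeForcingSet (BF 3) forcingEdges
forcingEdges-isEdgeForcingSet =
  from-yes (All.all? (λ (u , v) → edge? u v) forcingEdges) ,
  from-yes (allPairs? independent? forcingEdges) ,
  endpoints-forcingChain-closure forcingOrder (from-yes (forcingChain? (endpoints forcingEdges) forcingOrder))

-- [b₁b₂b₃;0] and [b̄₁b₂b₃;0] are both adjacent to exactly [b₁b₂b₃;1] and [b̄₁b₂b₃;1];
-- dually on level 3 with the last bit.
twinPairs : List (V × V)
twinPairs =
  (⟨ O , O , O ∣ # 0 ⟩ , ⟨ I , O , O ∣ # 0 ⟩) ∷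
  (⟨ O , I , O ∣ # 0 ⟩ , ⟨ I , I , O ∣ # 0 ⟩) ∷
  (⟨ O , O , I ∣ # 0 ⟩ , ⟨ I , O , I ∣ # 0 ⟩) ∷
  (⟨ O , I , I ∣ # 0 ⟩ , ⟨ I , I , I ∣ # 0 ⟩) ∷
  (⟨ O , O , O ∣ # 3 ⟩ , ⟨ O , O , I ∣ # 3 ⟩) ∷
  (⟨ I , O , O ∣ # 3 ⟩ , ⟨ I , O , I ∣ # 3 ⟩) ∷
  (⟨ O , I , O ∣ # 3 ⟩ , ⟨ O , I , I ∣ # 3 ⟩) ∷
  (⟨ I , I , O ∣ # 3 ⟩ , ⟨ I , I , I ∣ # 3 ⟩) ∷ []

twinClass : V → Maybe (Fin 8)
twinClass v =
  Maybe.map Any.index (dec⇒maybe (Any.any? (λ (x , y) → (v ≟ᵥ x) ⊎-dec (v ≟ᵥ y)) twinPairs))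

twinClass? : ∀ v c → Dec (twinClass v ≡ c)
twinClass? v = Maybe.≡-dec Fin._≟_ (twinClass v)

bf3TwinClasses : TwinClasses (BF 3) 8
bf3TwinClasses = record
  { twinPair          = List.lookup twinPairs
  ; twinPair-twins    = from-yes (Fin.all? λ i →
      twins? (proj₁ (List.lookup twinPairs i)) (proj₂ (List.lookup twinPairs i)))
  ; class             = twinClass
  ; class-twinPair₁   = from-yes (Fin.all? λ i → twinClass? (proj₁ (List.lookup twinPairs i)) (just i))
  ; class-twinPair₂   = from-yes (Fin.all? λ i → twinClass? (proj₂ (List.lookup twinPairs i)) (just i))
  ; edge-unclassified = λ {a} {b} → from-yes (all? λ a → all? λ b →
      edge? a b →-dec (twinClass? a nothing ⊎-dec twinClass? b nothing)) a b
  }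

theorem4p3 : EdgeForcingNumberIs (BF 3) 8
theorem4p3 =
  (forcingEdges , forcingEdges-isEdgeForcingSet , refl) ,
  λ _ → twinClasses⇒≤length (BF 3) bf3TwinClasses
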